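{- The relation $\hat R$, restricted to consistent pairs, is transitive and irreflexive.
   Context: Formulas and derivability $\varphi\vdash\psi$ are those of the calculus $\mathsf{QRC_1}$ (a strictly positive quantified modal calculus whose formulas are built from $\top$ and atomic formulas by $\wedge$, $\Diamond$, $\forall x$). For a set $\Gamma$ of formulas, $\Gamma\vdash\varphi$ means $\gamma_0\wedge\dots\wedge\gamma_n\vdash\varphi$ for some $\gamma_i\in\Gamma$. A pair is $p=\langle p^+,p^-\rangle$ of sets of formulas; $p$ is consistent if $p^+\not\vdash\delta$ for all $\delta\in p^-$. The relation $\hat R$ on pairs: $p\hat Rq$ iff (i) for every formula $\Diamond\varphi\in p^-$ we have $\varphi\in q^-$ and $\Diamond\varphi\in q^-$, and (ii) there is some formula $\Diamond\psi\in p^+\cap q^-$. -}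

module Defs where

open import Data.Nat using (ℕ; _≡ᵇ_)
open import Data.Bool using (Bool; true; false; _∨_; _∧_; not; if_then_else_; T)
open import Data.List using (List; []; _∷_; map; foldr)
open import Data.Bool.ListAction using (any)
open import Data.List.Relation.Unary.All using (All)
open import Data.Product using (Σ; _×_; ∃)
open import Relation.Nullary using (¬_)
open import Relation.Unary using (Pred; _∈_)
open import Level using (0ℓ)

-- Syntax of QRC₁ (variables and constants indexed by ℕ;
-- relation symbols indexed by ℕ, applied to a list of terms)

data Term : Set where
  var : ℕ → Term
  con : ℕ → Term

infixr 6 _∧'_
data Formula : Set where
  ⊤'   : Formula
  rel  : ℕ → List Term → Formula
  _∧'_ : Formula → Formula → Formula
  ◇    : Formula → Formula
  ∀'   : ℕ → Formula → Formula

termHasVar : ℕ → Term → Bool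
termHasVar x (var y) = x ≡ᵇ y
termHasVar x (con _) = false

termHasCon : ℕ → Term → Bool
termHasCon c (var _) = false
termHasCon c (con d) = c ≡ᵇ d

freeIn : ℕ → Formula → Bool
freeIn x ⊤'         = false
freeIn x (rel P ts) = any (termHasVar x) ts
freeIn x (φ ∧' ψ)   = freeIn x φ ∨ freeIn x ψ
freeIn x (◇ φ)      = freeIn x φ
freeIn x (∀' y φ)   = if y ≡ᵇ x then false else freeIn x φ

conIn : ℕ → Formula → Bool
conIn c ⊤'         = false
conIn c (rel P ts) = any (termHasCon c) ts
conIn c (φ ∧' ψ)   = conIn c φ ∨ conIn c ψ
conIn c (◇ φ)      = conIn c φ
conIn c (∀' y φ)   = conIn c φ

substTerm : ℕ → Term → Term → Term
substTerm x t (var y) = if x ≡ᵇ y then t else var y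
substTerm x t (con d) = con d

subst : ℕ → Term → Formula → Formula
subst x t ⊤'         = ⊤'
subst x t (rel P ts) = rel P (map (substTerm x t) ts)
subst x t (φ ∧' ψ)   = subst x t φ ∧' subst x t ψ
subst x t (◇ φ)      = ◇ (subst x t φ)
subst x t (∀' y φ)   = if y ≡ᵇ x then ∀' y φ else ∀' y (subst x t φ)

freeFor : Term → ℕ → Formula → Bool
freeFor t x ⊤'         = true
freeFor t x (rel P ts) = true
freeFor t x (φ ∧' ψ)   = freeFor t x φ ∧ freeFor t x ψ
freeFor t x (◇ φ)      = freeFor t x φ
freeFor t x (∀' y φ)   =
  if not (freeIn x (∀' y φ)) then true
  else (not (termHasVar y t) ∧ freeFor t x φ)

infix 4 _⊢_
data _⊢_ : Formula → Formula → Set where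
  top      : ∀ {φ} → φ ⊢ ⊤'
  ident    : ∀ {φ} → φ ⊢ φ
  ∧-elimˡ  : ∀ {φ ψ} → φ ∧' ψ ⊢ φ
  ∧-elimʳ  : ∀ {φ ψ} → φ ∧' ψ ⊢ ψ
  ∧-intro  : ∀ {φ ψ χ} → φ ⊢ ψ → φ ⊢ χ → φ ⊢ ψ ∧' χ
  cut      : ∀ {φ ψ χ} → φ ⊢ ψ → ψ ⊢ χ → φ ⊢ χ
  ◇-mono   : ∀ {φ ψ} → φ ⊢ ψ → ◇ φ ⊢ ◇ ψ
  ◇-trans  : ∀ {φ} → ◇ (◇ φ) ⊢ ◇ φ
  ∀-intro  : ∀ {φ ψ x} → T (not (freeIn x φ)) → φ ⊢ ψ → φ ⊢ ∀' x ψ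
  ∀-elim   : ∀ {φ ψ x t} → T (freeFor t x φ) → subst x t φ ⊢ ψ → ∀' x φ ⊢ ψ
  term-inst : ∀ {φ ψ x t} → T (freeFor t x φ) → T (freeFor t x ψ) →
              φ ⊢ ψ → subst x t φ ⊢ subst x t ψ
  const-gen : ∀ {φ ψ x c} → T (not (conIn c φ)) → T (not (conIn c ψ)) →
              subst x (con c) φ ⊢ subst x (con c) ψ → φ ⊢ ψ

FSet : Set₁
FSet = Pred Formula 0ℓ

conj : Formula → List Formula → Formula
conj γ []        = γ
conj γ (δ ∷ γs)  = γ ∧' conj δ γs

infix 4 _⊩_
_⊩_ : FSet → Formula → Set
Γ ⊩ φ = Σ Formula λ γ → Σ (List Formula) λ γs →
          (γ ∈ Γ) × All (_∈ Γ) γs × (conj γ γs ⊢ φ)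

record Pair : Set₁ where
  constructor ⟨_,_⟩
  field
    plus  : FSet
    minus : FSet
open Pair public

Consistent : Pair → Set
Consistent p = ∀ δ → δ ∈ minus p → ¬ (plus p ⊩ δ)

R̂ : Pair → Pair → Set
R̂ p q =
  (∀ φ → ◇ φ ∈ minus p → (φ ∈ minus q) × (◇ φ ∈ minus q)) ×
  (Σ Formula λ ψ → (◇ ψ ∈ plus p) × (◇ ψ ∈ minus q))

module Submission where

open import Defs
open import Data.List using ([])
open import Data.List.Relation.Unary.All using ([])
open import Data.Product using (_×_; _,_; proj₂)
open import Relation.Nullary using (¬_)
open import Relation.Unary using (_∈_)

∈⇒⊩ : ∀ {Γ φ} → φ ∈ Γ → Γ ⊩ φ
∈⇒⊩ {φ = φ} φ∈Γ = φ , [] , φ∈Γ , [] , ident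

-- The witness ◇ψ ∈ p⁺ ∩ q⁻ of p R̂ q is carried into r⁻ by clause (i) of q R̂ r.
R̂-trans : ∀ {p q r} → R̂ p q → R̂ q r → R̂ p r
R̂-trans (p⇒q , ψ , ◇ψ∈p⁺ , ◇ψ∈q⁻) (q⇒r , _) =
  (λ φ ◇φ∈p⁻ → q⇒r φ (proj₂ (p⇒q φ ◇φ∈p⁻))) , ψ , ◇ψ∈p⁺ , proj₂ (q⇒r ψ ◇ψ∈q⁻)

Consistent⇒¬R̂-refl : ∀ {p} → Consistent p → ¬ R̂ p p
Consistent⇒¬R̂-refl cons (_ , ψ , ◇ψ∈p⁺ , ◇ψ∈p⁻) = cons (◇ ψ) ◇ψ∈p⁻ (∈⇒⊩ ◇ψ∈p⁺)

lemma5p7 : ((p q r : Pair) → Consistent p → Consistent q → Consistent r →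
    R̂ p q → R̂ q r → R̂ p r)
    × ((p : Pair) → Consistent p → ¬ R̂ p p)
lemma5p7 = (λ p q r _ _ _ → R̂-trans {p} {q} {r}) , (λ _ → Consistent⇒¬R̂-refl)
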